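{- Let $k=\mathbb{F}_q$, $q=2^n$. The number of $k$-rational points $(x,y,z)$ with $xyz\neq 0$ on the affine surface $x^3+y^3+z^3=0$ is $(q-1)\left(|E_1(k)|-3\mu\right)$, where $E_1$ is the elliptic curve $y^2+y=x^3$ (counting projective points) and $\mu=|\mu_3(k)|$, which equals $3$ if $q$ is a square and $1$ otherwise.
   Context: $\mu_3(k)$ denotes the group of cube roots of unity in $k$. -}

module Defs where

open import Level using (Level; _⊔_; suc)
open import Data.Nat using (ℕ; _^_)
open import Data.List using (List; length; filter; cartesianProduct; map; concatMap)
open import Data.List.Membership.Setoid using () renaming (_∈_ to _∈ₛ_)
open import Data.List.Relation.Unary.AllPairs using (AllPairs)
open import Data.Product using (_×_; _,_; Σ)
open import Relation.Nullary using (¬_; Dec; ¬?; _×-dec_)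
open import Relation.Binary using (Decidable)
open import Relation.Unary using (Pred) renaming (Decidable to Decidable₁)
open import Algebra.Bundles using (CommutativeRing)

record IsFieldRing {c ℓ : Level} (R : CommutativeRing c ℓ) : Set (c ⊔ ℓ) where
  open CommutativeRing R
  field
    _≟_     : Decidable _≈_
    0≉1     : ¬ (0# ≈ 1#)
    inverse : ∀ x → ¬ (x ≈ 0#) → Σ Carrier λ y → (x * y) ≈ 1#

record FiniteField (c ℓ : Level) : Set (suc (c ⊔ ℓ)) where
  field
    cring   : CommutativeRing c ℓ
    isField : IsFieldRing cring
  open CommutativeRing cring public
  open IsFieldRing isField public
  field
    elements : List Carrier
    complete : ∀ x → _∈ₛ_ setoid x elements
    distinct : AllPairs (λ x y → ¬ (x ≈ y)) elements

  card : ℕ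
  card = length elements

  cube : Carrier → Carrier
  cube x = x * x * x

  countK : {p : Level} {P : Pred Carrier p} → Decidable₁ P → ℕ
  countK P? = length (filter P? elements)

  pairs : List (Carrier × Carrier)
  pairs = cartesianProduct elements elements

  triples : List (Carrier × Carrier × Carrier)
  triples = concatMap (λ x → map (λ yz → x , yz) pairs) elements

  mu3 : ℕ
  mu3 = countK (λ x → (cube x) ≟ 1#)

  E1-affine-count : ℕ
  E1-affine-count = length (filter (λ { (x , y) → ((y * y) + y) ≟ (cube x) }) pairs)

  -- |E₁(k)| : projective points = affine points + the point at infinity
  E1-count : ℕ
  E1-count = Data.Nat.suc E1-affine-count

  surfaceCount : ℕ
  surfaceCount = length (filter
    (λ { (x , y , z) → _×-dec_
           (((cube x + cube y) + cube z) ≟ 0#)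
           (¬? (((x * y) * z) ≟ 0#)) })
    triples)

{-# OPTIONS --safe #-}
module Submission where

-- A field with 2ⁿ elements has characteristic two, since otherwise x ↦ −x would pair off its
-- 2ⁿ − 1 nonzero elements. Scaling by x⁻¹ identifies the solutions (y, z) of x³ + y³ + z³ = 0,
-- xyz ≠ 0, for fixed x ≠ 0 with the points of the Fermat cubic u³ + v³ = 1 off the axes; call
-- their number F, so the surface has (q − 1) F points. The affine Fermat cubic has F + 2μ points
-- (μ on each axis), and a projective change of coordinates identifies it with E₁ minus the line
-- x = 1, which meets E₁ in the μ − 1 primitive cube roots of unity; with the point at infinity,
-- |E₁(k)| = F + 3μ.
-- The primitive cube roots are the 0 or 2 roots of y² + y + 1, and the Möbius map x ↦ 1 / (x + 1)
-- of order three acts freely on k ∖ {0, 1, ω, ω²}, so q ≡ 2 + (μ − 1) mod 3. As 2ⁿ mod 3 is 1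
-- for even n and 2 for odd n, μ = 3 exactly when q is a square.

module Counting where
  open import Level using (Level; _⊔_) renaming (suc to lsuc)
  open import Function using (_∘_)
  open import Data.Nat using (ℕ; suc; _+_; _*_; _≤_; z≤n; s≤s)
  open import Data.Nat.Properties using (+-suc; ≤-refl; ≤-antisym; ≤-trans; ≤-pred; module ≤-Reasoning)
  open import Relation.Binary.Definitions using (_Respects_)
  open import Data.Nat.Divisibility using (_∣_; _∣0; ∣-reflexive; ∣m∣n⇒∣m+n)
  open import Data.List using (List; []; _∷_; _++_; length; filter; map; concatMap; cartesianProduct)
  open import Data.List.Properties using (filter-notAll; filter-++; length-++; length-map; filter-≐)
  import Data.List.Relation.Unary.Any as Any
  open import Data.List.Relation.Unary.Any using (here; there)
  import Data.List.Relation.Unary.All as All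
  open import Data.List.Relation.Unary.All using (All; []; _∷_)
  import Data.List.Relation.Unary.All.Properties as Allₚ
  open import Data.List.Relation.Unary.AllPairs using ([]; _∷_)
  open import Data.List.Relation.Unary.Unique.Setoid using (Unique)
  import Data.List.Relation.Unary.Unique.Setoid.Properties as Unique
  open import Data.List.Relation.Unary.Enumerates.Setoid using (IsEnumeration)
  import Data.List.Relation.Unary.Enumerates.Setoid.Properties as Enumerates
  import Data.List.Membership.Setoid as Membership
  open import Data.List.Membership.Setoid.Properties using (∈-filter⁺; ∈-filter⁻; ∈-map⁻; ∈-resp-≈; ∉-resp-≈)
  open import Data.Product using (_×_; _,_; proj₁; proj₂; uncurry)
  open import Data.Product.Relation.Binary.Pointwise.NonDependent using (_×ₛ_)
  open import Relation.Binary using (Setoid; Decidable)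
  import Relation.Binary.PropositionalEquality as ≡
  open ≡ using (_≡_)
  open import Relation.Nullary using (¬_; yes; no; ¬?; _×-dec_)
  open import Relation.Unary using (Pred; ∁; _∩_; _⊆_) renaming (Decidable to Decidable₁)
  open import Relation.Unary.Properties using (_∩?_; ∁?)

  private
    variable
      a b ℓ ℓ₁ ℓ₂ p q r : Level

  module _ {A : Set a} {P : Pred A p} (P? : Decidable₁ P) where

    length-filter-++ : ∀ xs ys → length (filter P? (xs ++ ys)) ≡ length (filter P? xs) + length (filter P? ys)
    length-filter-++ xs ys = ≡.trans (≡.cong length (filter-++ P? xs ys)) (length-++ (filter P? xs))

    length-filter-map : {B : Set b} (f : B → A) → ∀ xs →
                        length (filter P? (map f xs)) ≡ length (filter (P? ∘ f) xs)
    length-filter-map f [] = ≡.refl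
    length-filter-map f (x ∷ xs) with P? (f x)
    ... | yes _ = ≡.cong suc (length-filter-map f xs)
    ... | no _  = length-filter-map f xs

  module _ {A : Set a} {P : Pred A p} {R : Pred A r} (P? : Decidable₁ P) (R? : Decidable₁ R) where

    length-filter-split : ∀ xs →
      length (filter P? xs) ≡ length (filter (P? ∩? R?) xs) + length (filter (P? ∩? ∁? R?) xs)
    length-filter-split [] = ≡.refl
    length-filter-split (x ∷ xs) with P? x | R? x
    ... | yes _ | yes _ = ≡.cong suc (length-filter-split xs)
    ... | yes _ | no _  = ≡.trans (≡.cong suc (length-filter-split xs)) (≡.sym (+-suc _ _))
    ... | no _  | _     = length-filter-split xs

  module _ {A : Set a} {R : Pred A r} (R? : Decidable₁ R) where

    length-filter-complement : ∀ xs → length xs ≡ length (filter R? xs) + length (filter (∁? R?) xs)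
    length-filter-complement [] = ≡.refl
    length-filter-complement (x ∷ xs) with R? x
    ... | yes _ = ≡.cong suc (length-filter-complement xs)
    ... | no _  = ≡.trans (≡.cong suc (length-filter-complement xs)) (≡.sym (+-suc _ _))

  module _ {A : Set a} {B : Set b} {P : Pred B p} {R : Pred A r}
           (P? : Decidable₁ P) (R? : Decidable₁ R) (fibre : A → List B) (n : ℕ)
           (full : ∀ x → R x → length (filter P? (fibre x)) ≡ n)
           (empty : ∀ x → ¬ R x → length (filter P? (fibre x)) ≡ 0) where

    length-filter-concatMap : ∀ xs → length (filter P? (concatMap fibre xs)) ≡ length (filter R? xs) * n
    length-filter-concatMap [] = ≡.refl
    length-filter-concatMap (x ∷ xs) with R? x
    ... | yes Rx = ≡.trans (length-filter-++ P? (fibre x) _) (≡.cong₂ _+_ (full x Rx) (length-filter-concatMap xs))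
    ... | no ¬Rx = ≡.trans (length-filter-++ P? (fibre x) _) (≡.cong₂ _+_ (empty x ¬Rx) (length-filter-concatMap xs))

  module Pigeonhole (S : Setoid a ℓ) (_≟_ : Decidable (Setoid._≈_ S)) where
    open Setoid S
    open Membership S
    open import Relation.Binary.Properties.Setoid S using (≉-respʳ)

    length-mono-⊆ : ∀ {xs ys} → Unique S xs → (∀ {x} → x ∈ xs → x ∈ ys) → length xs ≤ length ys
    length-mono-⊆ {[]} _ _ = z≤n
    length-mono-⊆ {x ∷ xs} {ys} (x≉xs ∷ xs!) xs⊆ys = begin
      suc (length xs)                        ≤⟨ s≤s (length-mono-⊆ xs! xs⊆ys-x) ⟩
      suc (length (filter (¬? ∘ (x ≟_)) ys))  ≤⟨ filter-notAll (¬? ∘ (x ≟_)) ys x∈ys ⟩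
      length ys                              ∎
      where
      open ≤-Reasoning
      x∈ys : Any.Any (λ y → ¬ ¬ x ≈ y) ys
      x∈ys = Any.map (λ x≈y x≉y → x≉y x≈y) (xs⊆ys (here refl))
      xs⊆ys-x : ∀ {z} → z ∈ xs → z ∈ filter (¬? ∘ (x ≟_)) ys
      xs⊆ys-x z∈xs =
        ∈-filter⁺ S (¬? ∘ (x ≟_)) ≉-respʳ (xs⊆ys (there z∈xs)) (All.lookupₛ S ≉-respʳ x≉xs z∈xs)

    length-filter≡length : {P : Pred Carrier p} (P? : Decidable₁ P) → P Respects _≈_ → ∀ {xs ys} →
      Unique S ys → Unique S xs → (∀ {x} → x ∈ ys → P x → x ∈ xs) → (∀ {x} → x ∈ xs → x ∈ ys × P x) →
      length (filter P? ys) ≡ length xs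
    length-filter≡length P? resp {ys = ys} unique-ys unique-xs ys∩P⊆xs xs⊆ys∩P = ≤-antisym
      (length-mono-⊆ (Unique.filter⁺ S P? unique-ys) (uncurry ys∩P⊆xs ∘ ∈-filter⁻ S P? resp {xs = ys}))
      (length-mono-⊆ unique-xs (uncurry (∈-filter⁺ S P? resp) ∘ xs⊆ys∩P))

  module _ {S : Setoid a ℓ₁} {T : Setoid b ℓ₂} {P : Pred (Setoid.Carrier S) p} where
    private
      module S = Setoid S
      module T = Setoid T

    map⁺-injectiveOn : ∀ {f xs} → (∀ {x y} → P x → P y → f x T.≈ f y → x S.≈ y) →
                       All P xs → Unique S xs → Unique T (map f xs)
    map⁺-injectiveOn inj [] [] = []
    map⁺-injectiveOn inj (Px ∷ Pxs) (x≉xs ∷ xs!) =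
      Allₚ.map⁺ (All.zipWith (λ (Py , x≉y) → x≉y ∘ inj Px Py) (Pxs , x≉xs)) ∷ map⁺-injectiveOn inj Pxs xs!

  record FiniteSetoid c ℓ : Set (lsuc (c ⊔ ℓ)) where
    field
      setoid : Setoid c ℓ
    open Setoid setoid public
    open Membership setoid public using (_∈_)
    field
      _≟_      : Decidable _≈_
      elements : List Carrier
      complete : IsEnumeration setoid elements
      unique   : Unique setoid elements

    ≈-resp : ∀ {y} → (_≈ y) Respects _≈_
    ≈-resp x≈z x≈y = trans (sym x≈z) x≈y

    ∩-resp : {P : Pred Carrier p} {Q : Pred Carrier q} → P Respects _≈_ → Q Respects _≈_ → (P ∩ Q) Respects _≈_
    ∩-resp P-resp Q-resp x≈y (Px , Qx) = P-resp x≈y Px , Q-resp x≈y Qx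

    ∁-resp : {P : Pred Carrier p} → P Respects _≈_ → (∁ P) Respects _≈_
    ∁-resp P-resp x≈y ¬Px Py = ¬Px (P-resp (sym x≈y) Py)

    count : {P : Pred Carrier p} → Decidable₁ P → ℕ
    count P? = length (filter P? elements)

    count-split : {P : Pred Carrier p} {R : Pred Carrier r} (P? : Decidable₁ P) (R? : Decidable₁ R) →
                  count P? ≡ count (P? ∩? R?) + count (P? ∩? ∁? R?)
    count-split P? R? = length-filter-split P? R? elements

    count-complement : {R : Pred Carrier r} (R? : Decidable₁ R) → length elements ≡ count R? + count (∁? R?)
    count-complement R? = length-filter-complement R? elements

    count-≐ : {P : Pred Carrier p} {Q : Pred Carrier q} (P? : Decidable₁ P) (Q? : Decidable₁ Q) →
              P ⊆ Q → Q ⊆ P → count P? ≡ count Q?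
    count-≐ P? Q? P⊆Q Q⊆P = ≡.cong length (filter-≐ P? Q? (P⊆Q , Q⊆P) elements)

    count≡length : {P : Pred Carrier p} (P? : Decidable₁ P) → P Respects _≈_ →
                   ∀ {xs} → Unique setoid xs → (∀ {x} → P x → x ∈ xs) → (∀ {x} → x ∈ xs → P x) →
                   count P? ≡ length xs
    count≡length P? resp unique-xs P⊆xs xs⊆P =
      length-filter≡length P? resp unique unique-xs (λ _ → P⊆xs) (λ x∈xs → complete _ , xs⊆P x∈xs)
      where open Pigeonhole setoid _≟_

    count-singleton : ∀ y → count (_≟ y) ≡ 1
    count-singleton y =
      count≡length (_≟ y) ≈-resp ([] ∷ []) here (λ { (here x≈y) → x≈y ; (there ()) })

  _×ᶠ_ : FiniteSetoid a ℓ₁ → FiniteSetoid b ℓ₂ → FiniteSetoid (a ⊔ b) (ℓ₁ ⊔ ℓ₂)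
  A ×ᶠ B = record
    { setoid   = A.setoid ×ₛ B.setoid
    ; _≟_      = λ (x , y) (x′ , y′) → (x A.≟ x′) ×-dec (y B.≟ y′)
    ; elements = cartesianProduct A.elements B.elements
    ; complete = Enumerates.cartesianProduct⁺ A.setoid B.setoid A.complete B.complete
    ; unique   = Unique.cartesianProduct⁺ A.setoid B.setoid A.unique B.unique
    }
    where
    module A = FiniteSetoid A
    module B = FiniteSetoid B

  module _ (A : FiniteSetoid a ℓ₁) (B : FiniteSetoid b ℓ₂) where
    private
      module A = FiniteSetoid A
      module B = FiniteSetoid B

    count-mono : {P : Pred A.Carrier p} {Q : Pred B.Carrier q} (P? : Decidable₁ P) (Q? : Decidable₁ Q) →
                 P Respects A._≈_ → Q Respects B._≈_ →
                 (f : A.Carrier → B.Carrier) → (∀ {x} → P x → Q (f x)) →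
                 (∀ {x y} → P x → P y → f x B.≈ f y → x A.≈ y) →
                 A.count P? ≤ B.count Q?
    count-mono P? Q? P-resp Q-resp f f-maps f-inj = begin
      length Ps          ≡⟨ length-map f Ps ⟨
      length (map f Ps)  ≤⟨ length-mono-⊆ unique-fPs fPs⊆Qs ⟩
      B.count Q?         ∎
      where
      open ≤-Reasoning
      open Pigeonhole B.setoid B._≟_
      Ps : List A.Carrier
      Ps = filter P? A.elements
      unique-fPs : Unique B.setoid (map f Ps)
      unique-fPs = map⁺-injectiveOn {S = A.setoid} {T = B.setoid} f-inj
        (Allₚ.all-filter P? A.elements) (Unique.filter⁺ A.setoid P? A.unique)
      fPs⊆Qs : ∀ {y} → y B.∈ map f Ps → y B.∈ filter Q? B.elements
      fPs⊆Qs y∈fPs with x , x∈Ps , y≈fx ← ∈-map⁻ A.setoid B.setoid y∈fPs =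
        ∈-filter⁺ B.setoid Q? Q-resp (B.complete _)
          (Q-resp (B.sym y≈fx) (f-maps (proj₂ (∈-filter⁻ A.setoid P? P-resp {xs = A.elements} x∈Ps))))

  module _ (A : FiniteSetoid a ℓ₁) (B : FiniteSetoid b ℓ₂) where
    private
      module A = FiniteSetoid A
      module B = FiniteSetoid B

    record Correspondence (P : Pred A.Carrier p) (Q : Pred B.Carrier q) : Set (a ⊔ b ⊔ ℓ₁ ⊔ ℓ₂ ⊔ p ⊔ q) where
      field
        to        : A.Carrier → B.Carrier
        from      : B.Carrier → A.Carrier
        to-cong   : ∀ {x y} → x A.≈ y → to x B.≈ to y
        from-cong : ∀ {x y} → x B.≈ y → from x A.≈ from y
        to-maps   : ∀ {x} → P x → Q (to x)
        from-maps : ∀ {y} → Q y → P (from y)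
        from∘to   : ∀ {x} → P x → from (to x) A.≈ x
        to∘from   : ∀ {y} → Q y → to (from y) B.≈ y

    count-≡ : {P : Pred A.Carrier p} {Q : Pred B.Carrier q} (P? : Decidable₁ P) (Q? : Decidable₁ Q) →
              P Respects A._≈_ → Q Respects B._≈_ → Correspondence P Q → A.count P? ≡ B.count Q?
    count-≡ P? Q? P-resp Q-resp P↔Q = ≤-antisym
      (count-mono A B P? Q? P-resp Q-resp to to-maps
        (λ Px Py e → A.trans (A.sym (from∘to Px)) (A.trans (from-cong e) (from∘to Py))))
      (count-mono B A Q? P? Q-resp P-resp from from-maps
        (λ Qx Qy e → B.trans (B.sym (to∘from Qx)) (B.trans (to-cong e) (to∘from Qy))))
      where open Correspondence P↔Q

  module _ (A : FiniteSetoid a ℓ) where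
    open FiniteSetoid A

    record OrbitPartition (G : Pred Carrier p) (d : ℕ) : Set (a ⊔ ℓ ⊔ p) where
      field
        orbit         : Carrier → List Carrier
        orbit-length  : ∀ {x} → G x → length (orbit x) ≡ d
        orbit-unique  : ∀ {x} → G x → Unique setoid (orbit x)
        ∈-orbit       : ∀ {x} → G x → x ∈ orbit x
        orbit-closed  : ∀ {x y} → G x → y ∈ orbit x → G y
        orbit-overlap : ∀ {x y z} → G x → G y → z ∈ orbit x → z ∈ orbit y → y ∈ orbit x

    orbits-divide-count : {G : Pred Carrier p} {d : ℕ} (G? : Decidable₁ G) → G Respects _≈_ →
                          OrbitPartition G d → d ∣ count G?
    orbits-divide-count {G = G} {d} G? G-resp π =
      d∣length _ (filter G? elements) ≤-refl (Unique.filter⁺ setoid G? unique) (proj₂ ∘ in-G)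
        (λ x∈Gs y∈Ox → ∈-filter⁺ setoid G? G-resp (complete _) (orbit-closed (proj₂ (in-G x∈Gs)) y∈Ox))
      where
      open OrbitPartition π
      open Pigeonhole setoid _≟_
      in-G : ∀ {x} → x ∈ filter G? elements → x ∈ elements × G x
      in-G = ∈-filter⁻ setoid G? G-resp

      -- Each step removes the orbit of the head; n bounds the length, for termination.
      d∣length : ∀ n xs → length xs ≤ n → Unique setoid xs → (∀ {x} → x ∈ xs → G x) →
                 (∀ {x y} → x ∈ xs → y ∈ orbit x → y ∈ xs) → d ∣ length xs
      d∣length _ [] _ _ _ _ = d ∣0
      d∣length (suc n) (x ∷ xs) (s≤s |xs|≤n) unique-L G-L closed-L =
        ≡.subst (d ∣_) (≡.sym (length-filter-complement ∈Ox? L))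
          (∣m∣n⇒∣m+n (∣-reflexive (≡.sym |Ox|≡d)) (d∣length n rest |rest|≤n unique-rest G-rest closed-rest))
        where
        L : List Carrier
        L = x ∷ xs
        Gx : G x
        Gx = G-L (here refl)
        ∈Ox? : Decidable₁ (_∈ orbit x)
        ∈Ox? y = Any.any? (y ≟_) (orbit x)
        rest : List Carrier
        rest = filter (∁? ∈Ox?) L
        |Ox|≡d : length (filter ∈Ox? L) ≡ d
        |Ox|≡d = ≡.trans
          (length-filter≡length ∈Ox? (∈-resp-≈ setoid) unique-L (orbit-unique Gx)
            (λ _ y∈Ox → y∈Ox) (λ y∈Ox → closed-L (here refl) y∈Ox , y∈Ox))
          (orbit-length Gx)
        |rest|≤n : length rest ≤ n
        |rest|≤n = ≤-trans (≤-pred (filter-notAll (∁? ∈Ox?) L (here (λ x∉Ox → x∉Ox (∈-orbit Gx))))) |xs|≤n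
        in-rest : ∀ {y} → y ∈ rest → y ∈ L × ¬ y ∈ orbit x
        in-rest = ∈-filter⁻ setoid (∁? ∈Ox?) (∉-resp-≈ setoid)
        unique-rest : Unique setoid rest
        unique-rest = Unique.filter⁺ setoid (∁? ∈Ox?) unique-L
        G-rest : ∀ {y} → y ∈ rest → G y
        G-rest = G-L ∘ proj₁ ∘ in-rest
        closed-rest : ∀ {y z} → y ∈ rest → z ∈ orbit y → z ∈ rest
        closed-rest y∈rest z∈Oy with y∈L , y∉Ox ← in-rest y∈rest =
          ∈-filter⁺ setoid (∁? ∈Ox?) (∉-resp-≈ setoid) (closed-L y∈L z∈Oy)
            (λ z∈Ox → y∉Ox (orbit-overlap Gx (G-L y∈L) z∈Ox z∈Oy))

    module _ {G : Pred Carrier p} (G-resp : G Respects _≈_)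
             (σ : Carrier → Carrier) (σ-cong : ∀ {x y} → x ≈ y → σ x ≈ σ y)
             (σ-closed : ∀ {x} → G x → G (σ x)) (σ-free : ∀ {x} → G x → ¬ σ x ≈ x) where

      involution-orbits : (∀ {x} → G x → σ (σ x) ≈ x) → OrbitPartition G 2
      involution-orbits σ²≈id = record
        { orbit         = orbit
        ; orbit-length  = λ _ → ≡.refl
        ; orbit-unique  = λ Gx → ((λ x≈σx → σ-free Gx (sym x≈σx)) ∷ []) ∷ [] ∷ []
        ; ∈-orbit       = λ _ → here refl
        ; orbit-closed  = orbit-closed
        ; orbit-overlap = orbit-overlap
        }
        where
        orbit : Carrier → List Carrier
        orbit x = x ∷ σ x ∷ []
        orbit-closed : ∀ {x y} → G x → y ∈ orbit x → G y
        orbit-closed Gx (here y≈x)               = G-resp (sym y≈x) Gx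
        orbit-closed Gx (there (here y≈σx))      = G-resp (sym y≈σx) (σ-closed Gx)
        σ-∈-orbit : ∀ {x z} → G x → z ∈ orbit x → σ z ∈ orbit x
        σ-∈-orbit Gx (here z≈x)          = there (here (σ-cong z≈x))
        σ-∈-orbit Gx (there (here z≈σx)) = here (trans (σ-cong z≈σx) (σ²≈id Gx))
        orbit-overlap : ∀ {x y z} → G x → G y → z ∈ orbit x → z ∈ orbit y → y ∈ orbit x
        orbit-overlap Gx Gy z∈Ox (here z≈y) = ∈-resp-≈ setoid z≈y z∈Ox
        orbit-overlap Gx Gy z∈Ox (there (here z≈σy)) =
          ∈-resp-≈ setoid (trans (σ-cong z≈σy) (σ²≈id Gy)) (σ-∈-orbit Gx z∈Ox)

      order-three-orbits : (∀ {x} → G x → σ (σ (σ x)) ≈ x) → OrbitPartition G 3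
      order-three-orbits σ³≈id = record
        { orbit         = orbit
        ; orbit-length  = λ _ → ≡.refl
        ; orbit-unique  = orbit-unique
        ; ∈-orbit       = λ _ → here refl
        ; orbit-closed  = orbit-closed
        ; orbit-overlap = orbit-overlap
        }
        where
        orbit : Carrier → List Carrier
        orbit x = x ∷ σ x ∷ σ (σ x) ∷ []
        orbit-unique : ∀ {x} → G x → Unique setoid (orbit x)
        orbit-unique Gx =
          ((λ x≈σx → σ-free Gx (sym x≈σx)) ∷
           (λ x≈σ²x → σ-free Gx (trans (σ-cong x≈σ²x) (σ³≈id Gx))) ∷ []) ∷
          ((λ σx≈σ²x → σ-free (σ-closed Gx) (sym σx≈σ²x)) ∷ []) ∷ [] ∷ []
        orbit-closed : ∀ {x y} → G x → y ∈ orbit x → G y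
        orbit-closed Gx (here y≈x)                  = G-resp (sym y≈x) Gx
        orbit-closed Gx (there (here y≈σx))         = G-resp (sym y≈σx) (σ-closed Gx)
        orbit-closed Gx (there (there (here y≈σ²x))) = G-resp (sym y≈σ²x) (σ-closed (σ-closed Gx))
        σ-∈-orbit : ∀ {x z} → G x → z ∈ orbit x → σ z ∈ orbit x
        σ-∈-orbit Gx (here z≈x)                  = there (here (σ-cong z≈x))
        σ-∈-orbit Gx (there (here z≈σx))         = there (there (here (σ-cong z≈σx)))
        σ-∈-orbit Gx (there (there (here z≈σ²x))) = here (trans (σ-cong z≈σ²x) (σ³≈id Gx))
        orbit-overlap : ∀ {x y z} → G x → G y → z ∈ orbit x → z ∈ orbit y → y ∈ orbit x
        orbit-overlap Gx Gy z∈Ox (here z≈y) = ∈-resp-≈ setoid z≈y z∈Ox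
        orbit-overlap Gx Gy z∈Ox (there (here z≈σy)) =
          ∈-resp-≈ setoid (trans (σ-cong (σ-cong z≈σy)) (σ³≈id Gy)) (σ-∈-orbit Gx (σ-∈-orbit Gx z∈Ox))
        orbit-overlap Gx Gy z∈Ox (there (there (here z≈σ²y))) =
          ∈-resp-≈ setoid (trans (σ-cong z≈σ²y) (σ³≈id Gy)) (σ-∈-orbit Gx z∈Ox)

module Arithmetic where
  open import Data.Nat using (ℕ; zero; suc; _+_; _*_; _^_; _<_; s≤s)
  open import Data.Nat.Properties using (+-comm; *-assoc)
  open import Data.Nat.DivMod using (_%_; %-distribˡ-*; m%n<n)
  open import Data.Nat.Divisibility using (_∣_; ∣m+n∣m⇒∣n; m∣m*n; ∣1⇒≡1)
  open import Data.Integer using (+_; _-_) renaming (_+_ to _+ℤ_; _*_ to _*ℤ_)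
  import Data.Integer.Properties as ℤ
  open import Data.Product using (Σ; _,_)
  open import Data.Sum using (_⊎_; inj₁; inj₂)
  open import Relation.Nullary using (contradiction)
  import Relation.Binary.PropositionalEquality as ≡
  open ≡ using (_≡_; _≢_; refl; cong; cong₂; sym; trans; subst)
  open ≡.≡-Reasoning

  square%3≢2 : ∀ m → m * m % 3 ≢ 2
  square%3≢2 m m²%3≡2 = residue-square (m % 3) (m%n<n m 3) (trans (sym (%-distribˡ-* m m 3)) m²%3≡2)
    where
    residue-square : ∀ r → r < 3 → r * r % 3 ≢ 2
    residue-square 0 _ ()
    residue-square 1 _ ()
    residue-square 2 _ ()
    residue-square (suc (suc (suc _))) (s≤s (s≤s (s≤s ())))

  2^n-square-or-≡2-mod-3 : ∀ n → (Σ ℕ λ m → m * m ≡ 2 ^ n) ⊎ 2 ^ n % 3 ≡ 2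
  2^n-square-or-≡2-mod-3 zero          = inj₁ (1 , refl)
  2^n-square-or-≡2-mod-3 (suc zero)    = inj₂ refl
  2^n-square-or-≡2-mod-3 (suc (suc n)) with 2^n-square-or-≡2-mod-3 n
  ... | inj₁ (m , m²≡2ⁿ) = inj₁ (2 * m , (begin
    2 * m * (2 * m)    ≡⟨ double-square m ⟩
    2 * (2 * (m * m))  ≡⟨ cong (λ t → 2 * (2 * t)) m²≡2ⁿ ⟩
    2 * (2 * 2 ^ n)    ∎))
    where
    open import Data.Nat.Tactic.RingSolver using (solve-∀)
    double-square : ∀ m → 2 * m * (2 * m) ≡ 2 * (2 * (m * m))
    double-square = solve-∀
  ... | inj₂ 2ⁿ%3≡2 = inj₂ (begin
    2 * (2 * 2 ^ n) % 3      ≡⟨ cong (_% 3) (*-assoc 2 2 (2 ^ n)) ⟨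
    4 * 2 ^ n % 3            ≡⟨ %-distribˡ-* 4 (2 ^ n) 3 ⟩
    1 * (2 ^ n % 3) % 3      ≡⟨ cong (λ r → 1 * r % 3) 2ⁿ%3≡2 ⟩
    2                        ∎)

  2^n≡1+even⇒n≡0 : ∀ n {c} → 2 ^ n ≡ suc c → 2 ∣ c → n ≡ 0
  2^n≡1+even⇒n≡0 zero    _        _   = refl
  2^n≡1+even⇒n≡0 (suc n) {c} 2ⁿ≡1+c 2∣c = contradiction (∣1⇒≡1 2∣1) λ ()
    where
    2∣1 : 2 ∣ 1
    2∣1 = ∣m+n∣m⇒∣n (subst (2 ∣_) (trans 2ⁿ≡1+c (+-comm 1 c)) (m∣m*n (2 ^ n))) 2∣c

  a*t≡[q-1]*[e-3m] : ∀ {q e a t m} → q ≡ suc a → e ≡ t + 3 * m →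
                     + (a * t) ≡ (+ q - + 1) *ℤ (+ e - + 3 *ℤ + m)
  a*t≡[q-1]*[e-3m] {a = a} {t} {m} refl refl = begin
    + (a * t)                                               ≡⟨ ℤ.pos-* a t ⟩
    + a *ℤ + t                                              ≡⟨ identity (+ a) (+ t) (+ m) ⟩
    (+ 1 +ℤ + a - + 1) *ℤ (+ t +ℤ + 3 *ℤ + m - + 3 *ℤ + m)
      ≡⟨ cong₂ (λ x y → (x - + 1) *ℤ (y - + 3 *ℤ + m))
               (ℤ.pos-+ 1 a) (trans (ℤ.pos-+ t (3 * m)) (cong (+ t +ℤ_) (ℤ.pos-* 3 m))) ⟨
    (+ suc a - + 1) *ℤ (+ (t + 3 * m) - + 3 *ℤ + m)         ∎
    where
    open import Data.Integer.Tactic.RingSolver using (solve-∀)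
    identity : ∀ a t m → a *ℤ t ≡ (+ 1 +ℤ a - + 1) *ℤ (t +ℤ + 3 *ℤ m - + 3 *ℤ m)
    identity = solve-∀

module Fields where
  open import Data.Bool using (Bool; true; false)
  open import Data.Bool.Properties using (xor-∧-commutativeRing)
  open import Data.Maybe using (Maybe; just; nothing)
  open import Data.Product using (proj₁; proj₂)
  open import Data.Sum using (_⊎_; inj₁; inj₂)
  open import Function using (_∘_)
  open import Relation.Nullary using (¬_; Dec; yes; no; contradiction)
  open import Level using (0ℓ)
  open import Algebra.Bundles using (CommutativeRing; RawRing)
  open import Algebra.Solver.Ring.AlmostCommutativeRing using (fromCommutativeSemiring; _-Raw-AlmostCommutative⟶_)
  open import Defs using (IsFieldRing)

  module FieldProperties {c ℓ} {R : CommutativeRing c ℓ} (isField : IsFieldRing R) where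
    open CommutativeRing R
    open IsFieldRing isField
    open import Relation.Binary.Reasoning.Setoid setoid

    -- 0 ⁻¹ = 0 is a junk value.
    infix 8 _⁻¹
    _⁻¹ : Carrier → Carrier
    x ⁻¹ with x ≟ 0#
    ... | yes _   = 0#
    ... | no x≉0 = proj₁ (inverse x x≉0)

    ⁻¹-inverseʳ : ∀ {x} → ¬ x ≈ 0# → x * x ⁻¹ ≈ 1#
    ⁻¹-inverseʳ {x} x≉0 with x ≟ 0#
    ... | yes x≈0 = contradiction x≈0 x≉0
    ... | no x≉0′ = proj₂ (inverse x x≉0′)

    ⁻¹-inverseˡ : ∀ {x} → ¬ x ≈ 0# → x ⁻¹ * x ≈ 1#
    ⁻¹-inverseˡ x≉0 = trans (*-comm _ _) (⁻¹-inverseʳ x≉0)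

    unit-nonzero : ∀ {x y} → x * y ≈ 1# → ¬ x ≈ 0#
    unit-nonzero {x} {y} xy≈1 x≈0 = 0≉1 (begin
      0#     ≈⟨ zeroˡ y ⟨
      0# * y ≈⟨ *-congʳ x≈0 ⟨
      x * y  ≈⟨ xy≈1 ⟩
      1#     ∎)

    ⁻¹-unique : ∀ {x y} → x * y ≈ 1# → x ⁻¹ ≈ y
    ⁻¹-unique {x} {y} xy≈1 = begin
      x ⁻¹            ≈⟨ *-identityʳ _ ⟨
      x ⁻¹ * 1#       ≈⟨ *-congˡ xy≈1 ⟨
      x ⁻¹ * (x * y)  ≈⟨ *-assoc _ _ _ ⟨
      x ⁻¹ * x * y    ≈⟨ *-congʳ (⁻¹-inverseˡ (unit-nonzero xy≈1)) ⟩
      1# * y          ≈⟨ *-identityˡ y ⟩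
      y               ∎

    ⁻¹-nonzero : ∀ {x} → ¬ x ≈ 0# → ¬ x ⁻¹ ≈ 0#
    ⁻¹-nonzero = unit-nonzero ∘ ⁻¹-inverseˡ

    ⁻¹-involutive : ∀ {x} → ¬ x ≈ 0# → x ⁻¹ ⁻¹ ≈ x
    ⁻¹-involutive = ⁻¹-unique ∘ ⁻¹-inverseˡ

    ⁻¹-zero : ∀ {x} → x ≈ 0# → x ⁻¹ ≈ 0#
    ⁻¹-zero {x} x≈0 with x ≟ 0#
    ... | yes _   = refl
    ... | no x≉0 = contradiction x≈0 x≉0

    ⁻¹-cong : ∀ {x y} → x ≈ y → x ⁻¹ ≈ y ⁻¹
    ⁻¹-cong {x} {y} x≈y = by-cases (x ≟ 0#)
      where
      by-cases : Dec (x ≈ 0#) → x ⁻¹ ≈ y ⁻¹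
      by-cases (yes x≈0) = trans (⁻¹-zero x≈0) (sym (⁻¹-zero (trans (sym x≈y) x≈0)))
      by-cases (no x≉0)  = sym (⁻¹-unique (trans (*-congʳ (sym x≈y)) (⁻¹-inverseʳ x≉0)))

    zero-product : ∀ {x y} → x * y ≈ 0# → x ≈ 0# ⊎ y ≈ 0#
    zero-product {x} {y} xy≈0 with x ≟ 0#
    ... | yes x≈0 = inj₁ x≈0
    ... | no x≉0 = inj₂ (begin
      y               ≈⟨ *-identityˡ y ⟨
      1# * y          ≈⟨ *-congʳ (⁻¹-inverseˡ x≉0) ⟨
      x ⁻¹ * x * y    ≈⟨ *-assoc _ _ _ ⟩
      x ⁻¹ * (x * y)  ≈⟨ *-congˡ xy≈0 ⟩
      x ⁻¹ * 0#       ≈⟨ zeroʳ _ ⟩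
      0#              ∎)

    *-nonzero : ∀ {x y} → ¬ x ≈ 0# → ¬ y ≈ 0# → ¬ x * y ≈ 0#
    *-nonzero x≉0 y≉0 xy≈0 with zero-product xy≈0
    ... | inj₁ x≈0 = x≉0 x≈0
    ... | inj₂ y≈0 = y≉0 y≈0

  HasCharacteristicTwo : ∀ {c ℓ} → CommutativeRing c ℓ → Set ℓ
  HasCharacteristicTwo R = 1# + 1# ≈ 0#
    where open CommutativeRing R

  module CharacteristicTwo {c ℓ} (R : CommutativeRing c ℓ) (1+1≈0 : HasCharacteristicTwo R) where
    open CommutativeRing R
    open import Relation.Binary.Reasoning.Setoid setoid

    -- The solver with coefficients in 𝔽₂ = (Bool, xor, ∧) proves identities modulo 1 + 1 ≈ 0.
    private
      𝔽₂ : RawRing 0ℓ 0ℓ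
      𝔽₂ = CommutativeRing.rawRing xor-∧-commutativeRing

      ⟦_⟧ : Bool → Carrier
      ⟦ false ⟧ = 0#
      ⟦ true ⟧  = 1#

      𝔽₂-embedding : 𝔽₂ -Raw-AlmostCommutative⟶ fromCommutativeSemiring commutativeSemiring
      𝔽₂-embedding = record
        { ⟦_⟧    = ⟦_⟧
        ; +-homo = λ where
            false b     → sym (+-identityˡ _)
            true false  → sym (+-identityʳ _)
            true true   → sym 1+1≈0
        ; *-homo = λ where
            false _ → sym (zeroˡ _)
            true _  → sym (*-identityˡ _)
        ; -‿homo = λ _ → refl
        ; 0-homo = refl
        ; 1-homo = refl
        }

      _≟𝔽₂_ : ∀ a b → Maybe (⟦ a ⟧ ≈ ⟦ b ⟧)
      false ≟𝔽₂ false = just refl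
      true  ≟𝔽₂ true  = just refl
      _     ≟𝔽₂ _     = nothing

    open import Algebra.Solver.Ring 𝔽₂ (fromCommutativeSemiring commutativeSemiring) 𝔽₂-embedding _≟𝔽₂_ public

    cubeᴾ : ∀ {n} → Polynomial n → Polynomial n
    cubeᴾ p = p :* p :* p

    x+y≈0⇒x≈y : ∀ {x y} → x + y ≈ 0# → x ≈ y
    x+y≈0⇒x≈y {x} {y} x+y≈0 = begin
      x            ≈⟨ solve 2 (λ x y → x := x :+ y :+ y) refl x y ⟩
      x + y + y    ≈⟨ +-congʳ x+y≈0 ⟩
      0# + y       ≈⟨ +-identityˡ y ⟩
      y            ∎

    x+1≈1⇒x≈0 : ∀ {x} → x + 1# ≈ 1# → x ≈ 0#
    x+1≈1⇒x≈0 {x} x+1≈1 = begin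
      x            ≈⟨ solve 1 (λ x → x := x :+ con true :+ con true) refl x ⟩
      x + 1# + 1#  ≈⟨ +-congʳ x+1≈1 ⟩
      1# + 1#      ≈⟨ 1+1≈0 ⟩
      0#           ∎

module FiniteFields where
  open import Function using (_∘_)
  import Data.Nat as ℕ
  open ℕ using (ℕ; suc; _^_; _≤_; s≤s)
  open import Data.Nat.Divisibility using (_∣_; divides)
  open import Data.Nat.DivMod using (_%_; [m+kn]%n≡m%n)
  open import Data.Nat.Tactic.RingSolver using (solve-∀)
  open import Data.List using (map)
  open import Data.List.Relation.Unary.Any using (here; there)
  import Data.List.Relation.Unary.Any as Any
  open import Data.List.Relation.Unary.All using ([]; _∷_)
  open import Data.List.Relation.Unary.AllPairs using ([]; _∷_)
  open import Data.Product using (_×_; _,_; proj₁; proj₂; Σ)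
  open import Data.Sum using (_⊎_; inj₁; inj₂; [_,_]′)
  open import Data.Empty using (⊥-elim)
  open import Data.Bool using (true; false)
  open import Relation.Nullary using (¬_; yes; no; ¬?; _×-dec_; contradiction)
  open import Relation.Unary using (Pred; ∁; _∩_) renaming (Decidable to Decidable₁)
  open import Relation.Unary.Properties using (_∩?_; ∁?)
  open import Relation.Binary.Definitions using (_Respects_)
  import Relation.Binary.PropositionalEquality as ≡
  open ≡ using (_≡_)
  import Relation.Binary.Reasoning.Setoid as SetoidReasoning
  import Algebra.Properties.Ring as RingProperties
  open import Defs
  open Counting
  open Arithmetic
  open Fields

  module _ {c ℓ} (k : FiniteField c ℓ) where
    open FiniteField k

    finiteSetoid : FiniteSetoid c ℓ
    finiteSetoid = record
      { setoid = setoid ; _≟_ = _≟_ ; elements = elements ; complete = complete ; unique = distinct }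

    private
      module K = FiniteSetoid finiteSetoid

    nonzeroCount : ℕ
    nonzeroCount = K.count (∁? (_≟ 0#))

    card≡1+nonzero : card ≡ suc nonzeroCount
    card≡1+nonzero = ≡.trans (K.count-complement (_≟ 0#)) (≡.cong (ℕ._+ nonzeroCount) (K.count-singleton 0#))

    2≤card : 2 ≤ card
    2≤card = Pigeonhole.length-mono-⊆ setoid _≟_ ((0≉1 ∷ []) ∷ [] ∷ []) (λ _ → complete _)

    characteristic-two : ∀ n → card ≡ 2 ^ n → HasCharacteristicTwo cring
    characteristic-two n q≡2ⁿ with (1# + 1#) ≟ 0#
    ... | yes 2≈0 = 2≈0
    ... | no 2≉0 = contradiction (≡.subst (2 ≤_) (≡.trans q≡2ⁿ (≡.cong (2 ^_) n≡0)) 2≤card) λ { (s≤s ()) }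
      where
      open FieldProperties isField
      open RingProperties ring using (-‿involutive; -‿injective; -0#≈0#)
      -‿nonzero : ∀ {x} → ¬ x ≈ 0# → ¬ - x ≈ 0#
      -‿nonzero x≉0 -x≈0 = x≉0 (-‿injective (trans -x≈0 (sym -0#≈0#)))
      -‿fixed-point-free : ∀ {x} → ¬ x ≈ 0# → ¬ - x ≈ x
      -‿fixed-point-free {x} x≉0 -x≈x = *-nonzero 2≉0 x≉0 (begin
        (1# + 1#) * x    ≈⟨ distribʳ x 1# 1# ⟩
        1# * x + 1# * x  ≈⟨ +-cong (*-identityˡ x) (*-identityˡ x) ⟩
        x + x            ≈⟨ +-congˡ -x≈x ⟨
        x + - x          ≈⟨ -‿inverseʳ x ⟩
        0#               ∎)
        where open SetoidReasoning setoid
      2∣nonzero : 2 ∣ nonzeroCount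
      2∣nonzero = orbits-divide-count finiteSetoid (∁? (_≟ 0#)) (K.∁-resp K.≈-resp)
        (involution-orbits finiteSetoid (K.∁-resp K.≈-resp) -_ -‿cong -‿nonzero -‿fixed-point-free
          (λ _ → -‿involutive _))
      n≡0 : n ≡ 0
      n≡0 = 2^n≡1+even⇒n≡0 n (≡.trans (≡.sym q≡2ⁿ) card≡1+nonzero) 2∣nonzero

  module CharacteristicTwoField {c ℓ} (k : FiniteField c ℓ) (1+1≈0 : HasCharacteristicTwo (FiniteField.cring k)) where
    open FiniteField k
    open FieldProperties isField
    open CharacteristicTwo cring 1+1≈0
    open SetoidReasoning setoid

    K : FiniteSetoid c ℓ
    K = finiteSetoid k

    K² : FiniteSetoid c ℓ
    K² = K ×ᶠ K

    module K = FiniteSetoid K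
    module K² = FiniteSetoid K²

    cube-cong : ∀ {x y} → x ≈ y → cube x ≈ cube y
    cube-cong x≈y = *-cong (*-cong x≈y x≈y) x≈y

    cube-1 : cube 1# ≈ 1#
    cube-1 = solve 0 (cubeᴾ (con true) := con true) refl

    cube-zero : ∀ {x} → x ≈ 0# → cube x ≈ 0#
    cube-zero x≈0 = trans (cube-cong x≈0) (solve 0 (cubeᴾ (con false) := con false) refl)

    x+1≉0 : ∀ {x} → ¬ x ≈ 1# → ¬ x + 1# ≈ 0#
    x+1≉0 x≉1 = x≉1 ∘ x+y≈0⇒x≈y

    -- In characteristic two, x² + x ≈ 1 is x² + x + 1 ≈ 0.
    IsPrimitiveCubeRoot : Pred Carrier ℓ
    IsPrimitiveCubeRoot x = x * x + x ≈ 1#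

    primitive? : Decidable₁ IsPrimitiveCubeRoot
    primitive? x = (x * x + x) ≟ 1#

    primitive-resp : IsPrimitiveCubeRoot Respects _≈_
    primitive-resp x≈y = trans (+-cong (*-cong (sym x≈y) (sym x≈y)) (sym x≈y))

    ¬primitive-0 : ¬ IsPrimitiveCubeRoot 0#
    ¬primitive-0 0²+0≈1 = 0≉1 (trans (sym (solve 0 (con false :* con false :+ con false := con false) refl)) 0²+0≈1)

    ¬primitive-1 : ¬ IsPrimitiveCubeRoot 1#
    ¬primitive-1 1²+1≈1 = 0≉1 (trans (sym (solve 0 (con true :* con true :+ con true := con false) refl)) 1²+1≈1)

    primitive-conjugate : ∀ {c} → IsPrimitiveCubeRoot c → IsPrimitiveCubeRoot (c + 1#)
    primitive-conjugate {c} =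
      trans (solve 1 (λ c → (c :+ con true) :* (c :+ con true) :+ (c :+ con true) := c :* c :+ c) refl c)

    c≉c+1 : ∀ {c} → ¬ c ≈ c + 1#
    c≉c+1 {c} c≈c+1 = 0≉1 (begin
      0#            ≈⟨ solve 1 (λ c → c :+ c := con false) refl c ⟨
      c + c         ≈⟨ +-congˡ c≈c+1 ⟩
      c + (c + 1#)  ≈⟨ solve 1 (λ c → c :+ (c :+ con true) := con true) refl c ⟩
      1#            ∎)

    primitive-roots : ∀ {c w} → IsPrimitiveCubeRoot c → IsPrimitiveCubeRoot w → w ≈ c ⊎ w ≈ c + 1#
    primitive-roots {c} {w} c²+c≈1 w²+w≈1 with zero-product [w+c][w+c+1]≈0
      where
      [w+c][w+c+1]≈0 : (w + c) * (w + c + 1#) ≈ 0#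
      [w+c][w+c+1]≈0 = begin
        (w + c) * (w + c + 1#)
          ≈⟨ solve 2 (λ w c → (w :+ c) :* (w :+ c :+ con true) := (w :* w :+ w) :+ (c :* c :+ c)) refl w c ⟩
        (w * w + w) + (c * c + c)  ≈⟨ +-cong w²+w≈1 c²+c≈1 ⟩
        1# + 1#                    ≈⟨ 1+1≈0 ⟩
        0#                         ∎
    ... | inj₁ w+c≈0   = inj₁ (x+y≈0⇒x≈y w+c≈0)
    ... | inj₂ w+c+1≈0 = inj₂ (x+y≈0⇒x≈y (trans (sym (+-assoc w c 1#)) w+c+1≈0))

    primitiveCubeRoots : ℕ
    primitiveCubeRoots = K.count primitive?

    cubeRootOfUnity? : Decidable₁ (λ x → cube x ≈ 1#)
    cubeRootOfUnity? x = cube x ≟ 1#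

    cube≈1-resp : (λ x → cube x ≈ 1#) Respects _≈_
    cube≈1-resp x≈y = trans (cube-cong (sym x≈y))

    OnE₁ : Pred (Carrier × Carrier) ℓ
    OnE₁ (x , y) = y * y + y ≈ cube x

    onE₁? : Decidable₁ OnE₁
    onE₁? (x , y) = (y * y + y) ≟ cube x

    onE₁-resp : OnE₁ Respects K²._≈_
    onE₁-resp (x≈x′ , y≈y′) on =
      trans (+-cong (*-cong (sym y≈y′) (sym y≈y′)) (sym y≈y′)) (trans on (cube-cong x≈x′))

    OnFermat : Pred (Carrier × Carrier) ℓ
    OnFermat (u , v) = cube u + cube v ≈ 1#

    onFermat? : Decidable₁ OnFermat
    onFermat? (u , v) = (cube u + cube v) ≟ 1#

    onFermat-resp : OnFermat Respects K²._≈_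
    onFermat-resp (u≈u′ , v≈v′) = trans (+-cong (cube-cong (sym u≈u′)) (cube-cong (sym v≈v′)))

    proj₁≟_ : ∀ a → Decidable₁ (λ (p : Carrier × Carrier) → proj₁ p ≈ a)
    (proj₁≟ a) (x , _) = x ≟ a

    proj₂≟_ : ∀ a → Decidable₁ (λ (p : Carrier × Carrier) → proj₂ p ≈ a)
    (proj₂≟ a) (_ , y) = y ≟ a

    proj₁≈-resp : ∀ {a} → (λ (p : Carrier × Carrier) → proj₁ p ≈ a) Respects K²._≈_
    proj₁≈-resp (x≈x′ , _) = K.≈-resp x≈x′

    proj₂≈-resp : ∀ {a} → (λ (p : Carrier × Carrier) → proj₂ p ≈ a) Respects K²._≈_
    proj₂≈-resp (_ , y≈y′) = K.≈-resp y≈y′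

    fermatPoints : ℕ
    fermatPoints = K².count onFermat?

    OnFermatTorus : Pred (Carrier × Carrier) ℓ
    OnFermatTorus = (OnFermat ∩ ∁ (λ p → proj₁ p ≈ 0#)) ∩ ∁ (λ p → proj₂ p ≈ 0#)

    onFermatTorus? : Decidable₁ OnFermatTorus
    onFermatTorus? = (onFermat? ∩? ∁? (proj₁≟ 0#)) ∩? ∁? (proj₂≟ 0#)

    onFermatTorus-resp : OnFermatTorus Respects K²._≈_
    onFermatTorus-resp =
      K².∩-resp (K².∩-resp onFermat-resp (K².∁-resp proj₁≈-resp)) (K².∁-resp proj₂≈-resp)

    fermatTorusPoints : ℕ
    fermatTorusPoints = K².count onFermatTorus?

    E₁-line↔primitive : Correspondence K² K (OnE₁ ∩ (λ p → proj₁ p ≈ 1#)) IsPrimitiveCubeRoot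
    E₁-line↔primitive = record
      { to        = proj₂
      ; from      = 1# ,_
      ; to-cong   = proj₂
      ; from-cong = refl ,_
      ; to-maps   = λ (on , x≈1) → trans on (trans (cube-cong x≈1) cube-1)
      ; from-maps = λ ω → trans ω (sym cube-1) , refl
      ; from∘to   = λ (_ , x≈1) → sym x≈1 , refl
      ; to∘from   = λ _ → refl
      }

    fermat-sum-nonzero : ∀ {u v} → OnFermat (u , v) → ¬ u + v ≈ 0#
    fermat-sum-nonzero {u} {v} on u+v≈0 = 0≉1 (begin
      0#                ≈⟨ solve 1 (λ v → cubeᴾ v :+ cubeᴾ v := con false) refl v ⟨
      cube v + cube v   ≈⟨ +-congʳ (cube-cong (x+y≈0⇒x≈y u+v≈0)) ⟨
      cube u + cube v   ≈⟨ on ⟩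
      1#                ∎)

    -- The projective change of coordinates (u : v : w) = (y + x : y + x + 1 : x + 1) maps E₁ onto
    -- the Fermat cubic u³ + v³ = w³, sending the line x = 1 to the line at infinity.
    E₁→Fermat : Carrier × Carrier → Carrier × Carrier
    E₁→Fermat (x , y) = (y + x) * (x + 1#) ⁻¹ , (y + x + 1#) * (x + 1#) ⁻¹

    Fermat→E₁ : Carrier × Carrier → Carrier × Carrier
    Fermat→E₁ (u , v) = (u + v) ⁻¹ + 1# , (u + 1#) * (u + v) ⁻¹ + 1#

    E₁→Fermat-maps : ∀ {p} → (OnE₁ ∩ ∁ (λ p → proj₁ p ≈ 1#)) p → OnFermat (E₁→Fermat p)
    E₁→Fermat-maps {x , y} (on , x≉1) = begin
      cube ((y + x) * i) + cube ((y + x + 1#) * i)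
        ≈⟨ solve 3 (λ x y i → cubeᴾ ((y :+ x) :* i) :+ cubeᴾ ((y :+ x :+ con true) :* i)
                            := (y :* y :+ y :+ cubeᴾ x :+ cubeᴾ (x :+ con true)) :* cubeᴾ i) refl x y i ⟩
      (y * y + y + cube x + cube (x + 1#)) * cube i  ≈⟨ *-congʳ (+-congʳ (+-congʳ on)) ⟩
      (cube x + cube x + cube (x + 1#)) * cube i
        ≈⟨ solve 2 (λ x i → (cubeᴾ x :+ cubeᴾ x :+ cubeᴾ (x :+ con true)) :* cubeᴾ i
                          := cubeᴾ ((x :+ con true) :* i)) refl x i ⟩
      cube ((x + 1#) * i)                            ≈⟨ cube-cong (⁻¹-inverseʳ (x+1≉0 x≉1)) ⟩
      cube 1#                                        ≈⟨ cube-1 ⟩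
      1#                                             ∎
      where
      i : Carrier
      i = (x + 1#) ⁻¹

    Fermat→E₁-maps : ∀ {p} → OnFermat p → (OnE₁ ∩ ∁ (λ p → proj₁ p ≈ 1#)) (Fermat→E₁ p)
    Fermat→E₁-maps {u , v} on = on-E₁ , a+1≉1
      where
      a : Carrier
      a = (u + v) ⁻¹
      a[u+v]≈1 : a * (u + v) ≈ 1#
      a[u+v]≈1 = ⁻¹-inverseˡ (fermat-sum-nonzero on)
      av≈au+1 : a * v ≈ a * u + 1#
      av≈au+1 = begin
        a * v                ≈⟨ solve 3 (λ u v a → a :* v := a :* (u :+ v) :+ a :* u) refl u v a ⟩
        a * (u + v) + a * u  ≈⟨ +-congʳ a[u+v]≈1 ⟩
        1# + a * u           ≈⟨ +-comm 1# (a * u) ⟩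
        a * u + 1#           ∎
      cubes : cube (a * u) + cube (a * u + 1#) ≈ cube a
      cubes = begin
        cube (a * u) + cube (a * u + 1#)  ≈⟨ +-congˡ (cube-cong av≈au+1) ⟨
        cube (a * u) + cube (a * v)
          ≈⟨ solve 3 (λ u v a → cubeᴾ (a :* u) :+ cubeᴾ (a :* v) := cubeᴾ a :* (cubeᴾ u :+ cubeᴾ v)) refl u v a ⟩
        cube a * (cube u + cube v)        ≈⟨ *-congˡ on ⟩
        cube a * 1#                       ≈⟨ *-identityʳ (cube a) ⟩
        cube a                            ∎
      on-E₁ : ((u + 1#) * a + 1#) * ((u + 1#) * a + 1#) + ((u + 1#) * a + 1#) ≈ cube (a + 1#)
      on-E₁ = begin
        ((u + 1#) * a + 1#) * ((u + 1#) * a + 1#) + ((u + 1#) * a + 1#)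
          ≈⟨ solve 2 (λ u a → let y = (u :+ con true) :* a :+ con true in y :* y :+ y
                            := cubeᴾ (a :* u) :+ cubeᴾ (a :* u :+ con true) :+ cubeᴾ a :+ cubeᴾ (a :+ con true)) refl u a ⟩
        cube (a * u) + cube (a * u + 1#) + cube a + cube (a + 1#)  ≈⟨ +-congʳ (+-congʳ cubes) ⟩
        cube a + cube a + cube (a + 1#)
          ≈⟨ solve 1 (λ a → cubeᴾ a :+ cubeᴾ a :+ cubeᴾ (a :+ con true) := cubeᴾ (a :+ con true)) refl a ⟩
        cube (a + 1#)                                               ∎
      a+1≉1 : ¬ a + 1# ≈ 1#
      a+1≉1 = ⁻¹-nonzero (fermat-sum-nonzero on) ∘ x+1≈1⇒x≈0

    Fermat→E₁∘E₁→Fermat : ∀ {p} → (OnE₁ ∩ ∁ (λ p → proj₁ p ≈ 1#)) p → Fermat→E₁ (E₁→Fermat p) K².≈ p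
    Fermat→E₁∘E₁→Fermat {x , y} (_ , x≉1) = x′≈x , y′≈y
      where
      i : Carrier
      i = (x + 1#) ⁻¹
      a≈x+1 : ((y + x) * i + (y + x + 1#) * i) ⁻¹ ≈ x + 1#
      a≈x+1 = trans (⁻¹-cong (solve 3 (λ x y i → (y :+ x) :* i :+ (y :+ x :+ con true) :* i := i) refl x y i))
                    (⁻¹-involutive (x+1≉0 x≉1))
      x′≈x : ((y + x) * i + (y + x + 1#) * i) ⁻¹ + 1# ≈ x
      x′≈x = trans (+-congʳ a≈x+1) (solve 1 (λ x → x :+ con true :+ con true := x) refl x)
      y′≈y : ((y + x) * i + 1#) * ((y + x) * i + (y + x + 1#) * i) ⁻¹ + 1# ≈ y
      y′≈y = begin
        ((y + x) * i + 1#) * ((y + x) * i + (y + x + 1#) * i) ⁻¹ + 1#  ≈⟨ +-congʳ (*-congˡ a≈x+1) ⟩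
        ((y + x) * i + 1#) * (x + 1#) + 1#
          ≈⟨ solve 3 (λ x y i → ((y :+ x) :* i :+ con true) :* (x :+ con true) :+ con true
                              := (y :+ x) :* (i :* (x :+ con true)) :+ x) refl x y i ⟩
        (y + x) * (i * (x + 1#)) + x  ≈⟨ +-congʳ (*-congˡ (⁻¹-inverseˡ (x+1≉0 x≉1))) ⟩
        (y + x) * 1# + x              ≈⟨ solve 2 (λ x y → (y :+ x) :* con true :+ x := y) refl x y ⟩
        y                             ∎

    E₁→Fermat∘Fermat→E₁ : ∀ {p} → OnFermat p → E₁→Fermat (Fermat→E₁ p) K².≈ p
    E₁→Fermat∘Fermat→E₁ {u , v} on = u′≈u , v′≈v
      where
      a : Carrier
      a = (u + v) ⁻¹
      a[u+v]≈1 : a * (u + v) ≈ 1#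
      a[u+v]≈1 = ⁻¹-inverseˡ (fermat-sum-nonzero on)
      [x+1]⁻¹≈u+v : (a + 1# + 1#) ⁻¹ ≈ u + v
      [x+1]⁻¹≈u+v = trans (⁻¹-cong (solve 1 (λ a → a :+ con true :+ con true := a) refl a))
                          (⁻¹-involutive (fermat-sum-nonzero on))
      u′≈u : ((u + 1#) * a + 1# + (a + 1#)) * (a + 1# + 1#) ⁻¹ ≈ u
      u′≈u = begin
        ((u + 1#) * a + 1# + (a + 1#)) * (a + 1# + 1#) ⁻¹
          ≈⟨ *-cong (solve 2 (λ u a → (u :+ con true) :* a :+ con true :+ (a :+ con true) := u :* a) refl u a)
                    [x+1]⁻¹≈u+v ⟩
        u * a * (u + v)    ≈⟨ *-assoc u a (u + v) ⟩
        u * (a * (u + v))  ≈⟨ *-congˡ a[u+v]≈1 ⟩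
        u * 1#             ≈⟨ *-identityʳ u ⟩
        u                  ∎
      v′≈v : ((u + 1#) * a + 1# + (a + 1#) + 1#) * (a + 1# + 1#) ⁻¹ ≈ v
      v′≈v = begin
        ((u + 1#) * a + 1# + (a + 1#) + 1#) * (a + 1# + 1#) ⁻¹  ≈⟨ *-congˡ [x+1]⁻¹≈u+v ⟩
        ((u + 1#) * a + 1# + (a + 1#) + 1#) * (u + v)
          ≈⟨ solve 3 (λ u v a → ((u :+ con true) :* a :+ con true :+ (a :+ con true) :+ con true) :* (u :+ v)
                              := u :* (a :* (u :+ v)) :+ u :+ v) refl u v a ⟩
        u * (a * (u + v)) + u + v  ≈⟨ +-congʳ (+-congʳ (*-congˡ a[u+v]≈1)) ⟩
        u * 1# + u + v             ≈⟨ solve 2 (λ u v → u :* con true :+ u :+ v := v) refl u v ⟩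
        v                          ∎

    E₁-off-line↔Fermat : Correspondence K² K² (OnE₁ ∩ ∁ (λ p → proj₁ p ≈ 1#)) OnFermat
    E₁-off-line↔Fermat = record
      { to        = E₁→Fermat
      ; from      = Fermat→E₁
      ; to-cong   = λ (x≈x′ , y≈y′) → let i≈i′ = ⁻¹-cong (+-congʳ x≈x′) in
                      *-cong (+-cong y≈y′ x≈x′) i≈i′ , *-cong (+-congʳ (+-cong y≈y′ x≈x′)) i≈i′
      ; from-cong = λ (u≈u′ , v≈v′) → let a≈a′ = ⁻¹-cong (+-cong u≈u′ v≈v′) in
                      +-congʳ a≈a′ , +-congʳ (*-cong (+-congʳ u≈u′) a≈a′)
      ; to-maps   = E₁→Fermat-maps
      ; from-maps = Fermat→E₁-maps
      ; from∘to   = Fermat→E₁∘E₁→Fermat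
      ; to∘from   = E₁→Fermat∘Fermat→E₁
      }

    cube-zero+ : ∀ {u} v → u ≈ 0# → cube u + cube v ≈ cube v
    cube-zero+ v u≈0 = trans (+-congʳ (cube-zero u≈0)) (+-identityˡ (cube v))

    +cube-zero : ∀ u {v} → v ≈ 0# → cube u + cube v ≈ cube u
    +cube-zero u v≈0 = trans (+-congˡ (cube-zero v≈0)) (+-identityʳ (cube u))

    Fermat-axis₁↔μ₃ : Correspondence K² K (OnFermat ∩ (λ p → proj₁ p ≈ 0#)) (λ v → cube v ≈ 1#)
    Fermat-axis₁↔μ₃ = record
      { to        = proj₂
      ; from      = 0# ,_
      ; to-cong   = proj₂
      ; from-cong = refl ,_
      ; to-maps   = λ {(u , v)} (on , u≈0) → trans (sym (cube-zero+ v u≈0)) on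
      ; from-maps = λ {v} v³≈1 → trans (cube-zero+ v refl) v³≈1 , refl
      ; from∘to   = λ (_ , u≈0) → sym u≈0 , refl
      ; to∘from   = λ _ → refl
      }

    Fermat-axis₂↔μ₃ :
      Correspondence K² K ((OnFermat ∩ ∁ (λ p → proj₁ p ≈ 0#)) ∩ (λ p → proj₂ p ≈ 0#)) (λ u → cube u ≈ 1#)
    Fermat-axis₂↔μ₃ = record
      { to        = proj₁
      ; from      = _, 0#
      ; to-cong   = proj₁
      ; from-cong = _, refl
      ; to-maps   = λ {(u , v)} ((on , _) , v≈0) → trans (sym (+cube-zero u v≈0)) on
      ; from-maps = λ {u} u³≈1 →
                      (trans (+cube-zero u refl) u³≈1 , λ u≈0 → 0≉1 (trans (sym (cube-zero u≈0)) u³≈1)) , refl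
      ; from∘to   = λ (_ , v≈0) → refl , sym v≈0
      ; to∘from   = λ _ → refl
      }


    cube≈1∖1⇒primitive : ∀ {x} → cube x ≈ 1# × ¬ x ≈ 1# → IsPrimitiveCubeRoot x
    cube≈1∖1⇒primitive {x} (x³≈1 , x≉1) with zero-product [x+1][x²+x+1]≈0
      where
      [x+1][x²+x+1]≈0 : (x + 1#) * (x * x + x + 1#) ≈ 0#
      [x+1][x²+x+1]≈0 = begin
        (x + 1#) * (x * x + x + 1#)
          ≈⟨ solve 1 (λ x → (x :+ con true) :* (x :* x :+ x :+ con true) := cubeᴾ x :+ con true) refl x ⟩
        cube x + 1#  ≈⟨ +-congʳ x³≈1 ⟩
        1# + 1#      ≈⟨ 1+1≈0 ⟩
        0#           ∎
    ... | inj₁ x+1≈0 = contradiction x+1≈0 (x+1≉0 x≉1)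
    ... | inj₂ x²+x+1≈0 = x+y≈0⇒x≈y x²+x+1≈0

    primitive⇒cube≈1∖1 : ∀ {x} → IsPrimitiveCubeRoot x → cube x ≈ 1# × ¬ x ≈ 1#
    primitive⇒cube≈1∖1 {x} x²+x≈1 = x³≈1 , x≉1
      where
      x³≈1 : cube x ≈ 1#
      x³≈1 = begin
        cube x
          ≈⟨ solve 1 (λ x → cubeᴾ x := x :* (x :* x :+ x) :+ (x :* x :+ x) :+ x) refl x ⟩
        x * (x * x + x) + (x * x + x) + x  ≈⟨ +-congʳ (+-cong (*-congˡ x²+x≈1) x²+x≈1) ⟩
        x * 1# + 1# + x                    ≈⟨ solve 1 (λ x → x :* con true :+ con true :+ x := con true) refl x ⟩
        1#                                 ∎
      x≉1 : ¬ x ≈ 1#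
      x≉1 x≈1 = ¬primitive-1 (primitive-resp x≈1 x²+x≈1)


    OnSurface : Pred (Carrier × Carrier × Carrier) ℓ
    OnSurface (x , y , z) = (cube x + cube y + cube z ≈ 0#) × ¬ x * y * z ≈ 0#

    onSurface? : Decidable₁ OnSurface
    onSurface? (x , y , z) = ((cube x + cube y + cube z) ≟ 0#) ×-dec ¬? ((x * y * z) ≟ 0#)

    onSurface-fibre-resp : ∀ x → (OnSurface ∘ (x ,_)) Respects K²._≈_
    onSurface-fibre-resp x (y≈y′ , z≈z′) (sum≈0 , xyz≉0) =
      trans (+-cong (+-congˡ (cube-cong (sym y≈y′))) (cube-cong (sym z≈z′))) sum≈0 ,
      λ xyz′≈0 → xyz≉0 (trans (*-cong (*-congˡ y≈y′) z≈z′) xyz′≈0)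

    onSurface⇒nonzero : ∀ {x y z} → OnSurface (x , y , z) → ¬ x ≈ 0# × ¬ y ≈ 0# × ¬ z ≈ 0#
    onSurface⇒nonzero {x} {y} {z} (_ , xyz≉0) =
      (λ x≈0 → xyz≉0 (trans (*-congʳ (*-congʳ x≈0)) (trans (*-congʳ (zeroˡ y)) (zeroˡ z)))) ,
      (λ y≈0 → xyz≉0 (trans (*-congʳ (*-congˡ y≈0)) (trans (*-congʳ (zeroʳ x)) (zeroˡ z)))) ,
      (λ z≈0 → xyz≉0 (trans (*-congˡ z≈0) (zeroʳ (x * y))))

    surface-fibre↔Fermat-torus : ∀ {x} → ¬ x ≈ 0# → Correspondence K² K² (OnSurface ∘ (x ,_)) OnFermatTorus
    surface-fibre↔Fermat-torus {x} x≉0 = record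
      { to        = λ (y , z) → y * x ⁻¹ , z * x ⁻¹
      ; from      = λ (u , v) → x * u , x * v
      ; to-cong   = λ (y≈y′ , z≈z′) → *-congʳ y≈y′ , *-congʳ z≈z′
      ; from-cong = λ (u≈u′ , v≈v′) → *-congˡ u≈u′ , *-congˡ v≈v′
      ; to-maps   = to-maps
      ; from-maps = from-maps
      ; from∘to   = λ _ → x[yx⁻¹]≈y _ , x[yx⁻¹]≈y _
      ; to∘from   = λ _ → [xu]x⁻¹≈u _ , [xu]x⁻¹≈u _
      }
      where
      x[yx⁻¹]≈y : ∀ y → x * (y * x ⁻¹) ≈ y
      x[yx⁻¹]≈y y = begin
        x * (y * x ⁻¹)  ≈⟨ solve 3 (λ x y i → x :* (y :* i) := y :* (x :* i)) refl x y (x ⁻¹) ⟩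
        y * (x * x ⁻¹)  ≈⟨ *-congˡ (⁻¹-inverseʳ x≉0) ⟩
        y * 1#          ≈⟨ *-identityʳ y ⟩
        y               ∎
      [xu]x⁻¹≈u : ∀ u → x * u * x ⁻¹ ≈ u
      [xu]x⁻¹≈u u = trans (solve 3 (λ x u i → x :* u :* i := x :* (u :* i)) refl x u (x ⁻¹)) (x[yx⁻¹]≈y u)
      to-maps : ∀ {p} → OnSurface (x , p) → OnFermatTorus (proj₁ p * x ⁻¹ , proj₂ p * x ⁻¹)
      to-maps {y , z} on@(sum≈0 , _) =
        (fermat , *-nonzero y≉0 (⁻¹-nonzero x≉0)) , *-nonzero z≉0 (⁻¹-nonzero x≉0)
        where
        y≉0 : ¬ y ≈ 0#
        y≉0 = proj₁ (proj₂ (onSurface⇒nonzero on))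
        z≉0 : ¬ z ≈ 0#
        z≉0 = proj₂ (proj₂ (onSurface⇒nonzero on))
        fermat : cube (y * x ⁻¹) + cube (z * x ⁻¹) ≈ 1#
        fermat = begin
          cube (y * x ⁻¹) + cube (z * x ⁻¹)
            ≈⟨ solve 4 (λ x y z i → cubeᴾ (y :* i) :+ cubeᴾ (z :* i)
                                  := (cubeᴾ x :+ cubeᴾ y :+ cubeᴾ z) :* cubeᴾ i :+ cubeᴾ (x :* i)) refl x y z (x ⁻¹) ⟩
          (cube x + cube y + cube z) * cube (x ⁻¹) + cube (x * x ⁻¹)
            ≈⟨ +-cong (*-congʳ sum≈0) (cube-cong (⁻¹-inverseʳ x≉0)) ⟩
          0# * cube (x ⁻¹) + cube 1#
            ≈⟨ solve 1 (λ t → con false :* t :+ cubeᴾ (con true) := con true) refl (cube (x ⁻¹)) ⟩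
          1#
            ∎
      from-maps : ∀ {p} → OnFermatTorus p → OnSurface (x , x * proj₁ p , x * proj₂ p)
      from-maps {u , v} ((fermat , u≉0) , v≉0) =
        sum≈0 , *-nonzero (*-nonzero x≉0 (*-nonzero x≉0 u≉0)) (*-nonzero x≉0 v≉0)
        where
        sum≈0 : cube x + cube (x * u) + cube (x * v) ≈ 0#
        sum≈0 = begin
          cube x + cube (x * u) + cube (x * v)
            ≈⟨ solve 3 (λ x u v → cubeᴾ x :+ cubeᴾ (x :* u) :+ cubeᴾ (x :* v)
                                := cubeᴾ x :* (cubeᴾ u :+ cubeᴾ v :+ con true)) refl x u v ⟩
          cube x * (cube u + cube v + 1#)  ≈⟨ *-congˡ (+-congʳ fermat) ⟩
          cube x * (1# + 1#)               ≈⟨ solve 1 (λ x → cubeᴾ x :* (con true :+ con true) := con false) refl x ⟩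
          0#                               ∎

    NotIn𝔽₄ : Pred Carrier ℓ
    NotIn𝔽₄ = (∁ IsPrimitiveCubeRoot ∩ ∁ (_≈ 0#)) ∩ ∁ (_≈ 1#)

    notIn𝔽₄? : Decidable₁ NotIn𝔽₄
    notIn𝔽₄? = (∁? primitive? ∩? ∁? (_≟ 0#)) ∩? ∁? (_≟ 1#)

    notIn𝔽₄-resp : NotIn𝔽₄ Respects _≈_
    notIn𝔽₄-resp = K.∩-resp (K.∩-resp (K.∁-resp primitive-resp) (K.∁-resp K.≈-resp)) (K.∁-resp K.≈-resp)

    -- The Möbius transformation σ x = 1 / (x + 1) has order three on ℙ¹(k), cycling 0 ↦ 1 ↦ ∞ ↦ 0;
    -- its fixed points are the primitive cube roots of unity.
    σ : Carrier → Carrier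
    σ x = (x + 1#) ⁻¹

    σ-cong : ∀ {x y} → x ≈ y → σ x ≈ σ y
    σ-cong = ⁻¹-cong ∘ +-congʳ

    σ[x]*[x+1]≈1 : ∀ {x} → ¬ x ≈ 1# → σ x * (x + 1#) ≈ 1#
    σ[x]*[x+1]≈1 = ⁻¹-inverseˡ ∘ x+1≉0

    σ-free : ∀ {x} → NotIn𝔽₄ x → ¬ σ x ≈ x
    σ-free {x} ((¬ωx , _) , x≉1) σx≈x = ¬ωx (begin
      x * x + x         ≈⟨ solve 1 (λ x → x :* x :+ x := x :* (x :+ con true)) refl x ⟩
      x * (x + 1#)      ≈⟨ *-congʳ σx≈x ⟨
      σ x * (x + 1#)    ≈⟨ σ[x]*[x+1]≈1 x≉1 ⟩
      1#                ∎)

    σ-closed : ∀ {x} → NotIn𝔽₄ x → NotIn𝔽₄ (σ x)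
    σ-closed {x} ((¬ωx , x≉0) , x≉1) = (¬ωσx , ⁻¹-nonzero (x+1≉0 x≉1)) , σx≉1
      where
      y : Carrier
      y = σ x
      σx≉1 : ¬ y ≈ 1#
      σx≉1 y≈1 = x≉0 (x+1≈1⇒x≈0 (begin
        x + 1#    ≈⟨ ⁻¹-involutive (x+1≉0 x≉1) ⟨
        y ⁻¹      ≈⟨ ⁻¹-cong y≈1 ⟩
        1# ⁻¹     ≈⟨ ⁻¹-unique (*-identityʳ 1#) ⟩
        1#        ∎))
      ¬ωσx : ¬ IsPrimitiveCubeRoot y
      ¬ωσx y²+y≈1 = ¬ωx (begin
        x * x + x
          ≈⟨ solve 1 (λ x → x :* x :+ x := (x :+ con true) :* (x :+ con true) :* con true :+ (x :+ con true)) refl x ⟩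
        (x + 1#) * (x + 1#) * 1# + (x + 1#)            ≈⟨ +-congʳ (*-congˡ y²+y≈1) ⟨
        (x + 1#) * (x + 1#) * (y * y + y) + (x + 1#)
          ≈⟨ solve 2 (λ x y → (x :+ con true) :* (x :+ con true) :* (y :* y :+ y) :+ (x :+ con true)
                            := (y :* (x :+ con true)) :* (y :* (x :+ con true))
                               :+ (y :* (x :+ con true) :+ con true) :* (x :+ con true)) refl x y ⟩
        (y * (x + 1#)) * (y * (x + 1#)) + (y * (x + 1#) + 1#) * (x + 1#)
          ≈⟨ +-cong (*-cong yx≈1 yx≈1) (*-congʳ (+-congʳ yx≈1)) ⟩
        1# * 1# + (1# + 1#) * (x + 1#)
          ≈⟨ solve 1 (λ x → con true :* con true :+ (con true :+ con true) :* (x :+ con true) := con true) refl x ⟩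
        1#                                             ∎)
        where
        yx≈1 : y * (x + 1#) ≈ 1#
        yx≈1 = σ[x]*[x+1]≈1 x≉1

    σ³≈id : ∀ {x} → NotIn𝔽₄ x → σ (σ (σ x)) ≈ x
    σ³≈id {x} ((_ , x≉0) , x≉1) = trans (⁻¹-cong (+-congʳ σ²x≈[x+1]/x)) (⁻¹-unique [[x+1]/x+1]*x≈1)
      where
      σ²x≈[x+1]/x : σ (σ x) ≈ (x + 1#) * x ⁻¹
      σ²x≈[x+1]/x = ⁻¹-unique (begin
        (σ x + 1#) * ((x + 1#) * x ⁻¹)
          ≈⟨ solve 3 (λ x y i → (y :+ con true) :* ((x :+ con true) :* i) := (y :* (x :+ con true) :+ x :+ con true) :* i)
                     refl x (σ x) (x ⁻¹) ⟩
        (σ x * (x + 1#) + x + 1#) * x ⁻¹  ≈⟨ *-congʳ (+-congʳ (+-congʳ (σ[x]*[x+1]≈1 x≉1))) ⟩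
        (1# + x + 1#) * x ⁻¹              ≈⟨ solve 2 (λ x i → (con true :+ x :+ con true) :* i := x :* i) refl x (x ⁻¹) ⟩
        x * x ⁻¹                          ≈⟨ ⁻¹-inverseʳ x≉0 ⟩
        1#                                ∎)
      [[x+1]/x+1]*x≈1 : ((x + 1#) * x ⁻¹ + 1#) * x ≈ 1#
      [[x+1]/x+1]*x≈1 = begin
        ((x + 1#) * x ⁻¹ + 1#) * x
          ≈⟨ solve 2 (λ x i → ((x :+ con true) :* i :+ con true) :* x := (x :+ con true) :* (x :* i) :+ x) refl x (x ⁻¹) ⟩
        (x + 1#) * (x * x ⁻¹) + x  ≈⟨ +-congʳ (*-congˡ (⁻¹-inverseʳ x≉0)) ⟩
        (x + 1#) * 1# + x          ≈⟨ solve 1 (λ x → (x :+ con true) :* con true :+ x := con true) refl x ⟩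
        1#                         ∎

  module CharacteristicTwoCounts {c ℓ} (k : FiniteField c ℓ) (1+1≈0 : HasCharacteristicTwo (FiniteField.cring k)) where
    open FiniteField k
    open CharacteristicTwoField k 1+1≈0 public
    open ≡.≡-Reasoning

    E₁-affine-count≡primitive+fermat : E1-affine-count ≡ primitiveCubeRoots ℕ.+ fermatPoints
    E₁-affine-count≡primitive+fermat = ≡.trans (K².count-split onE₁? (proj₁≟ 1#)) (≡.cong₂ ℕ._+_
      (count-≡ K² K _ primitive? (K².∩-resp onE₁-resp proj₁≈-resp) primitive-resp E₁-line↔primitive)
      (count-≡ K² K² _ onFermat? (K².∩-resp onE₁-resp (K².∁-resp proj₁≈-resp)) onFermat-resp
        E₁-off-line↔Fermat))

    fermatPoints≡μ₃+μ₃+torus : fermatPoints ≡ mu3 ℕ.+ (mu3 ℕ.+ fermatTorusPoints)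
    fermatPoints≡μ₃+μ₃+torus = ≡.trans (K².count-split onFermat? (proj₁≟ 0#)) (≡.cong₂ ℕ._+_
      (count-≡ K² K _ cubeRootOfUnity? (K².∩-resp onFermat-resp proj₁≈-resp) cube≈1-resp Fermat-axis₁↔μ₃)
      (≡.trans (K².count-split (onFermat? ∩? ∁? (proj₁≟ 0#)) (proj₂≟ 0#)) (≡.cong (ℕ._+ fermatTorusPoints)
        (count-≡ K² K _ cubeRootOfUnity? (K².∩-resp (K².∩-resp onFermat-resp (K².∁-resp proj₁≈-resp)) proj₂≈-resp)
          cube≈1-resp Fermat-axis₂↔μ₃))))

    mu3≡1+primitive : mu3 ≡ suc primitiveCubeRoots
    mu3≡1+primitive = ≡.trans (K.count-split cubeRootOfUnity? (_≟ 1#)) (≡.cong₂ ℕ._+_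
      (≡.trans (K.count-≐ _ (_≟ 1#) proj₂ (λ x≈1 → trans (cube-cong x≈1) cube-1 , x≈1)) (K.count-singleton 1#))
      (K.count-≐ _ primitive? cube≈1∖1⇒primitive primitive⇒cube≈1∖1))

    E1-count≡torus+3μ₃ : E1-count ≡ fermatTorusPoints ℕ.+ 3 ℕ.* mu3
    E1-count≡torus+3μ₃ = begin
      suc E1-affine-count
        ≡⟨ ≡.cong suc E₁-affine-count≡primitive+fermat ⟩
      suc primitiveCubeRoots ℕ.+ fermatPoints
        ≡⟨ ≡.cong₂ ℕ._+_ mu3≡1+primitive (≡.sym fermatPoints≡μ₃+μ₃+torus) ⟨
      mu3 ℕ.+ (mu3 ℕ.+ (mu3 ℕ.+ fermatTorusPoints))
        ≡⟨ rearrange mu3 fermatTorusPoints ⟩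
      fermatTorusPoints ℕ.+ 3 ℕ.* mu3
        ∎
      where
      rearrange : ∀ m t → m ℕ.+ (m ℕ.+ (m ℕ.+ t)) ≡ t ℕ.+ 3 ℕ.* m
      rearrange = solve-∀

    surfaceCount≡nonzero*torus : surfaceCount ≡ nonzeroCount k ℕ.* fermatTorusPoints
    surfaceCount≡nonzero*torus =
      length-filter-concatMap onSurface? (∁? (_≟ 0#)) (λ x → map (x ,_) pairs) fermatTorusPoints
      (λ x x≉0 → ≡.trans (length-filter-map onSurface? (x ,_) pairs)
        (count-≡ K² K² _ onFermatTorus? (onSurface-fibre-resp x) onFermatTorus-resp (surface-fibre↔Fermat-torus x≉0)))
      (λ x ¬x≉0 → ≡.trans (length-filter-map onSurface? (x ,_) pairs)
        (K².count≡length _ (onSurface-fibre-resp x) [] (⊥-elim ∘ ¬x≉0 ∘ proj₁ ∘ onSurface⇒nonzero) λ ()))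
      elements

    primitiveCubeRoots≡0⊎2 : primitiveCubeRoots ≡ 0 ⊎ primitiveCubeRoots ≡ 2
    primitiveCubeRoots≡0⊎2 with Any.any? primitive? elements
    ... | no ∄ω  = inj₁ (K.count≡length primitive? primitive-resp []
                     (λ {x} ωx → ⊥-elim (∄ω (Any.map (λ x≈y → primitive-resp x≈y ωx) (complete x)))) λ ())
    ... | yes ∃ω = inj₂ (two-roots (proj₂ (Any.satisfied ∃ω)))
      where
      two-roots : ∀ {c} → IsPrimitiveCubeRoot c → primitiveCubeRoots ≡ 2
      two-roots ωc = K.count≡length primitive? primitive-resp ((c≉c+1 ∷ []) ∷ [] ∷ [])
        (λ ωw → [ here , there ∘ here ]′ (primitive-roots ωc ωw))
        λ { (here w≈c) → primitive-resp (sym w≈c) ωc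
          ; (there (here w≈c+1)) → primitive-resp (sym w≈c+1) (primitive-conjugate ωc) }

    card≡primitive+2+notIn𝔽₄ : card ≡ primitiveCubeRoots ℕ.+ suc (suc (K.count notIn𝔽₄?))
    card≡primitive+2+notIn𝔽₄ = begin
      card
        ≡⟨ K.count-complement primitive? ⟩
      primitiveCubeRoots ℕ.+ K.count (∁? primitive?)
        ≡⟨ ≡.cong (primitiveCubeRoots ℕ.+_) (K.count-split (∁? primitive?) (_≟ 0#)) ⟩
      primitiveCubeRoots ℕ.+ (K.count (∁? primitive? ∩? (_≟ 0#)) ℕ.+ K.count (∁? primitive? ∩? ∁? (_≟ 0#)))
        ≡⟨ ≡.cong (primitiveCubeRoots ℕ.+_) (≡.cong₂ ℕ._+_ only-0 (K.count-split (∁? primitive? ∩? ∁? (_≟ 0#)) (_≟ 1#))) ⟩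
      primitiveCubeRoots ℕ.+ suc (K.count ((∁? primitive? ∩? ∁? (_≟ 0#)) ∩? (_≟ 1#)) ℕ.+ K.count notIn𝔽₄?)
        ≡⟨ ≡.cong (λ m → primitiveCubeRoots ℕ.+ suc (m ℕ.+ K.count notIn𝔽₄?)) only-1 ⟩
      primitiveCubeRoots ℕ.+ suc (suc (K.count notIn𝔽₄?))
        ∎
      where
      only-0 : K.count (∁? primitive? ∩? (_≟ 0#)) ≡ 1
      only-0 = ≡.trans (K.count-≐ _ (_≟ 0#) proj₂ (λ x≈0 → ¬primitive-0 ∘ primitive-resp x≈0 , x≈0))
                       (K.count-singleton 0#)
      only-1 : K.count ((∁? primitive? ∩? ∁? (_≟ 0#)) ∩? (_≟ 1#)) ≡ 1
      only-1 = ≡.trans (K.count-≐ _ (_≟ 1#) proj₂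
        (λ x≈1 → (¬primitive-1 ∘ primitive-resp x≈1 , λ x≈0 → 0≉1 (trans (sym x≈0) x≈1)) , x≈1)) (K.count-singleton 1#)

    3∣notIn𝔽₄ : 3 ∣ K.count notIn𝔽₄?
    3∣notIn𝔽₄ = orbits-divide-count K notIn𝔽₄? notIn𝔽₄-resp
      (order-three-orbits K notIn𝔽₄-resp σ σ-cong σ-closed σ-free σ³≈id)

    card%3≡[2+primitive]%3 : card % 3 ≡ (2 ℕ.+ primitiveCubeRoots) % 3
    card%3≡[2+primitive]%3 with divides d |notIn𝔽₄|≡3d ← 3∣notIn𝔽₄ = begin
      card % 3                                       ≡⟨ ≡.cong (_% 3) card≡primitive+2+notIn𝔽₄ ⟩
      (primitiveCubeRoots ℕ.+ suc (suc (K.count notIn𝔽₄?))) % 3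
        ≡⟨ ≡.cong (λ m → (primitiveCubeRoots ℕ.+ suc (suc m)) % 3) |notIn𝔽₄|≡3d ⟩
      (primitiveCubeRoots ℕ.+ suc (suc (d ℕ.* 3))) % 3
        ≡⟨ ≡.cong (_% 3) (rearrange primitiveCubeRoots (d ℕ.* 3)) ⟩
      (2 ℕ.+ primitiveCubeRoots ℕ.+ d ℕ.* 3) % 3      ≡⟨ [m+kn]%n≡m%n (2 ℕ.+ primitiveCubeRoots) d 3 ⟩
      (2 ℕ.+ primitiveCubeRoots) % 3                 ∎
      where
      rearrange : ∀ w m → w ℕ.+ suc (suc m) ≡ 2 ℕ.+ w ℕ.+ m
      rearrange = solve-∀

    mu3≡3-if-square : Σ ℕ (λ m → m ℕ.* m ≡ card) → mu3 ≡ 3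
    mu3≡3-if-square (m , m²≡q) with primitiveCubeRoots≡0⊎2
    ... | inj₂ ω≡2 = ≡.trans mu3≡1+primitive (≡.cong suc ω≡2)
    ... | inj₁ ω≡0 = contradiction
      (≡.trans (≡.cong (_% 3) m²≡q) (≡.trans card%3≡[2+primitive]%3 (≡.cong (λ w → (2 ℕ.+ w) % 3) ω≡0)))
      (square%3≢2 m)

    mu3≡1-if-not-square : ∀ n → card ≡ 2 ^ n → ¬ Σ ℕ (λ m → m ℕ.* m ≡ card) → mu3 ≡ 1
    mu3≡1-if-not-square n q≡2ⁿ nonsquare with primitiveCubeRoots≡0⊎2 | 2^n-square-or-≡2-mod-3 n
    ... | inj₁ ω≡0 | _                = ≡.trans mu3≡1+primitive (≡.cong suc ω≡0)
    ... | inj₂ _   | inj₁ (m , m²≡2ⁿ) = contradiction (m , ≡.trans m²≡2ⁿ (≡.sym q≡2ⁿ)) nonsquare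
    ... | inj₂ ω≡2 | inj₂ 2ⁿ%3≡2      = contradiction
      (≡.trans (≡.sym 2ⁿ%3≡2) (≡.trans (≡.cong (_% 3) (≡.sym q≡2ⁿ))
        (≡.trans card%3≡[2+primitive]%3 (≡.cong (λ w → (2 ℕ.+ w) % 3) ω≡2))))
      λ ()


open import Defs
open import Level using (Level)
open import Data.Nat using (ℕ; _^_)
open import Data.Integer using (ℤ; +_; _-_; _*_)
open import Data.Product using (_×_; Σ; _,_)
open import Relation.Nullary using (¬_)
open import Relation.Binary.PropositionalEquality using (_≡_; cong; trans)
open Arithmetic using (a*t≡[q-1]*[e-3m])
open FiniteFields

lemma2p3 : {c ℓ : Level} (k : FiniteField c ℓ) (n : ℕ) →
    FiniteField.card k ≡ 2 ^ n →
    ((+ FiniteField.surfaceCount k)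
       ≡ (+ FiniteField.card k - + 1) * (+ FiniteField.E1-count k - + 3 * + FiniteField.mu3 k))
    × ((Σ ℕ (λ m → m Data.Nat.* m ≡ FiniteField.card k)) → FiniteField.mu3 k ≡ 3)
    × (¬ (Σ ℕ (λ m → m Data.Nat.* m ≡ FiniteField.card k)) → FiniteField.mu3 k ≡ 1)
lemma2p3 k n q≡2ⁿ =
    trans (cong +_ surfaceCount≡nonzero*torus)
          (a*t≡[q-1]*[e-3m] {m = mu3} (card≡1+nonzero k) E1-count≡torus+3μ₃)
  , mu3≡3-if-square
  , mu3≡1-if-not-square n q≡2ⁿ
  where
  open FiniteField k using (mu3)
  open CharacteristicTwoCounts k (characteristic-two k n q≡2ⁿ)
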